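{- Let $\mathcal{Q}$ be a non-empty, connected quasi-crystal of type $A_{n-1}$ whose quasi-crystal graph is bounded above and which satisfies the local quasi-crystal axioms LQ1, LQ2, LQ3 and LQ3$'$. Then $\mathcal{Q}$ has a unique highest weight element.
   Context: Fix $n\ge 2$, $I=\{1,\dots,n-1\}$, weight lattice $\mathbb{Z}^n$ with the standard inner product $\langle\cdot,\cdot\rangle$, and simple roots $\alpha_i=\mathbf{e}_i-\mathbf{e}_{i+1}$. On $\mathbb{Z}\sqcup\{ -\infty,+\infty\}$ set $m+(\pm\infty)=(\pm\infty)+m=\pm\infty$ for $m\in\mathbb{Z}$. A quasi-crystal of type $A_{n-1}$ is a non-empty set $\mathcal{Q}$ with maps $\ddot e_i,\ddot f_i:\mathcal{Q}\to\mathcal{Q}\sqcup\{\bot\}$, $\ddot\varepsilon_i,\ddot\varphi_i:\mathcal{Q}\to\mathbb{Z}\sqcup\{ -\infty,+\infty\}$ ($i\in I$) and $\mathrm{wt}:\mathcal{Q}\to\mathbb{Z}^n$ such that: (Q1) $\ddot e_i(x)=y$ iff $x=\ddot f_i(y)$, and then $\mathrm{wt}(y)=\mathrm{wt}(x)+\alpha_i$, $\ddot\varepsilon_i(y)=\ddot\varepsilon_i(x)-1$, $\ddot\varphi_i(y)=\ddot\varphi_i(x)+1$; (Q2) $\ddot\varphi_i(x)=\ddot\varepsilon_i(x)+\langle\mathrm{wt}(x),\alpha_i\rangle$; (Q3) if $\ddot\varepsilon_i(x)=-\infty$ then $\ddot e_i(x)=\ddot f_i(x)=\bot$; (Q4)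 if $\ddot\varepsilon_i(x)=+\infty$ then $\ddot e_i(x)=\ddot f_i(x)=\bot$. Its quasi-crystal graph has vertex set $\mathcal{Q}$, an $i$-labelled edge $x\to y$ iff $\ddot f_i(x)=y$, and an $i$-labelled loop at $x$ iff $\ddot\varepsilon_i(x)=\ddot\varphi_i(x)=+\infty$; connected means this graph is connected. Local quasi-crystal axioms (for all $i,j\in I$, $x,y\in\mathcal{Q}$): (LQ1) if $i+1\in I$: $\ddot\varepsilon_i(x)=0\iff\ddot\varphi_{i+1}(x)=0$. (LQ2) if $\ddot e_i(x)=y$ then: (1) $\ddot\varepsilon_j(x)=\ddot\varepsilon_j(y)$ for $|i-j|>1$; (2) if $i+1\in I$: $\ddot\varepsilon_{i+1}(x)\ne\ddot\varepsilon_{i+1}(y)$ holds iff ($\ddot\varepsilon_{i+1}(x)=+\infty$ and $\ddot\varepsilon_i(y)=0$), and in that case $\ddot\varepsilon_{i+1}(y)\neq 0$; (3) if $i-1\in I$: $\ddot\varphi_{i-1}(x)\ne\ddot\varphi_{i-1}(y)$ holds iff ($\ddot\varphi_{i-1}(y)=+\infty$ and $\ddot\varphi_i(x)=0$), and in that case $\ddot\varphi_{i-1}(x)\ne 0$. (LQ3) if $i\ne j$ and $\ddot e_i(x)\neq\bot\neq\ddot e_j(x)$, then $\ddot e_i\ddot e_j(x)=\ddot e_j\ddot e_i(x)\neq\bot$. (LQ3$'$) same with $\ddot f$ in place of $\ddot e$. A highest weight element is $x$ with $\ddot e_i(x)=\bot$ for all $i\in I$. Write $x\prec y$ if $\ddot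 e_{i_1}\cdots\ddot e_{i_N}(x)=y$ for some $N\ge1$ and $i_1,\dots,i_N\in I$; $\mathcal{Q}$ is bounded above if for every $x$ there is a highest weight element $x_h$ with $x\preceq x_h$. -}

module Defs where

open import Level using (0ℓ)
open import Data.Nat as ℕ using (ℕ; zero; suc)
open import Data.Fin using (Fin; toℕ; inject₁) renaming (zero to fzero; suc to fsuc)
open import Data.Fin.Properties using () renaming (_≟_ to _≟ᶠ_)
open import Data.Integer using (ℤ; +_; -_; _-_) renaming (_+_ to _+ℤ_)
open import Data.Maybe using (Maybe; just; nothing; _>>=_)
open import Data.Product using (Σ; ∃; _×_; _,_)
open import Data.Sum using (_⊎_)
open import Relation.Nullary using (¬_; yes; no)
open import Relation.Binary.PropositionalEquality using (_≡_; _≢_)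
open import Relation.Binary.Construct.Closure.Equivalence using (EqClosure)
open import Relation.Binary.Construct.Closure.ReflexiveTransitive using (Star)

-- Convention: n = k + 2 (so n ≥ 2), index set I = {1,…,n-1} ≅ Fin (suc k),
-- weight lattice ℤⁿ ≅ Fin (suc (suc k)) → ℤ.  The index i : Fin (suc k)
-- stands for i+1 ∈ I; α_i = e_{inject₁ i} − e_{fsuc i}.

Idx : ℕ → Set
Idx k = Fin (suc k)

Weight : ℕ → Set
Weight k = Fin (suc (suc k)) → ℤ

data ℤ∞ : Set where
  fin  : ℤ → ℤ∞
  neg∞ : ℤ∞
  pos∞ : ℤ∞

infixr 20 _⊕_
_⊕_ : ℤ → ℤ∞ → ℤ∞
m ⊕ fin a = fin (m +ℤ a)
m ⊕ neg∞    = neg∞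
m ⊕ pos∞  = pos∞

δ : ∀ {n} → Fin n → Fin n → ℤ
δ i j with i ≟ᶠ j
... | yes _ = + 1
... | no  _ = + 0

α : ∀ {k} → Idx k → Weight k
α i j = δ (inject₁ i) j - δ (fsuc i) j

⟨_,α_⟩ : ∀ {k} → Weight k → Idx k → ℤ
⟨ w ,α i ⟩ = w (inject₁ i) - w (fsuc i)

Next : ∀ {k} → Idx k → Idx k → Set
Next i j = toℕ j ≡ suc (toℕ i)

Far : ∀ {k} → Idx k → Idx k → Set
Far i j = (suc (toℕ i) ℕ.< toℕ j) ⊎ (suc (toℕ j) ℕ.< toℕ i)

-- Quasi-crystal of type A_{n-1}, n = k+2.  ⊥ is represented by nothing.

record QuasiCrystal (k : ℕ) : Set₁ where
  field
    Q    : Set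
    elt  : Q
    ë    : Idx k → Q → Maybe Q
    f̈    : Idx k → Q → Maybe Q
    ε̈    : Idx k → Q → ℤ∞
    φ̈    : Idx k → Q → ℤ∞
    wt   : Q → Weight k
    Q1-iff : ∀ i x y → (ë i x ≡ just y → f̈ i y ≡ just x) × (f̈ i y ≡ just x → ë i x ≡ just y)
    Q1-wt  : ∀ i x y → ë i x ≡ just y → ∀ c → wt y c ≡ wt x c +ℤ α i c
    Q1-ε   : ∀ i x y → ë i x ≡ just y → ε̈ i y ≡ (- + 1) ⊕ ε̈ i x
    Q1-φ   : ∀ i x y → ë i x ≡ just y → φ̈ i y ≡ (+ 1) ⊕ φ̈ i x
    Q2     : ∀ i x → φ̈ i x ≡ ⟨ wt x ,α i ⟩ ⊕ ε̈ i x
    Q3     : ∀ i x → ε̈ i x ≡ neg∞ → (ë i x ≡ nothing) × (f̈ i x ≡ nothing)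
    Q4     : ∀ i x → ε̈ i x ≡ pos∞ → (ë i x ≡ nothing) × (f̈ i x ≡ nothing)

module _ {k : ℕ} (C : QuasiCrystal k) where
  open QuasiCrystal C

  -- edges of the quasi-crystal graph (loops do not affect connectivity)
  Edge : Q → Q → Set
  Edge x y = ∃ λ i → f̈ i x ≡ just y

  Connected : Set
  Connected = ∀ x y → EqClosure Edge x y

  HighestWeight : Q → Set
  HighestWeight x = ∀ i → ë i x ≡ nothing

  Raise : Q → Q → Set
  Raise x y = ∃ λ i → ë i x ≡ just y

  _⪯_ : Q → Q → Set
  _⪯_ = Star Raise

  BoundedAbove : Set
  BoundedAbove = ∀ x → ∃ λ xh → HighestWeight xh × (x ⪯ xh)

  LQ1 : Set
  LQ1 = ∀ i j → Next i j → ∀ x →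
          (ε̈ i x ≡ fin (+ 0) → φ̈ j x ≡ fin (+ 0)) × (φ̈ j x ≡ fin (+ 0) → ε̈ i x ≡ fin (+ 0))

  LQ2 : Set
  LQ2 = ∀ i x y → ë i x ≡ just y →
          (∀ j → Far i j → ε̈ j x ≡ ε̈ j y)
        × (∀ j → Next i j →
             ((ε̈ j x ≢ ε̈ j y) → (ε̈ j x ≡ pos∞ × ε̈ i y ≡ fin (+ 0)))
           × ((ε̈ j x ≡ pos∞ × ε̈ i y ≡ fin (+ 0)) → (ε̈ j x ≢ ε̈ j y))
           × ((ε̈ j x ≢ ε̈ j y) → ε̈ j y ≢ fin (+ 0)))
        × (∀ j → Next j i →
             ((φ̈ j x ≢ φ̈ j y) → (φ̈ j y ≡ pos∞ × φ̈ i x ≡ fin (+ 0)))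
           × ((φ̈ j y ≡ pos∞ × φ̈ i x ≡ fin (+ 0)) → (φ̈ j x ≢ φ̈ j y))
           × ((φ̈ j x ≢ φ̈ j y) → φ̈ j x ≢ fin (+ 0)))

  LQ3 : Set
  LQ3 = ∀ i j x → i ≢ j → ë i x ≢ nothing → ë j x ≢ nothing →
          ∃ λ z → (ë j x >>= ë i) ≡ just z × (ë i x >>= ë j) ≡ just z

  LQ3′ : Set
  LQ3′ = ∀ i j x → i ≢ j → f̈ i x ≢ nothing → f̈ j x ≢ nothing →
          ∃ λ z → (f̈ j x >>= f̈ i) ≡ just z × (f̈ i x >>= f̈ j) ≡ just z

{-# OPTIONS --safe #-}
-- The raising operators ë_i make the quasi-crystal a rewriting system whose
-- normal forms are exactly the highest weight elements.  LQ3 says two distinct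
-- raisings of x can be completed to a common element in one further step each,
-- so the system is subcommutative and hence confluent.  In a confluent system,
-- elements connected by the graph share at most one normal form; boundedness
-- above supplies one.
module Submission where

open import Defs
open import Level using (Level)
open import Data.Nat using (ℕ)
open import Data.Product using (∃; _×_; _,_; proj₂)
open import Data.Maybe using (Maybe; just; nothing)
open import Data.Maybe.Properties using (just-injective)
open import Data.Fin.Properties using (_≟_)
open import Relation.Nullary using (yes; no)
open import Relation.Binary.Core using (Rel)
open import Relation.Binary.PropositionalEquality using (_≡_; _≢_; refl; sym; trans)
open import Relation.Binary.Construct.Closure.ReflexiveTransitive using (Star; ε; _◅_; _◅◅_)
open import Relation.Binary.Construct.Closure.Reflexive using (ReflClosure; refl; [_])
open import Relation.Binary.Construct.Closure.Equivalence
  using (EqClosure; fold; isEquivalence; symmetric; return)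
open import Relation.Binary.Rewriting using (Confluent; IsNormalForm; conf⇒unf)

private
  variable
    a ℓ : Level
    A : Set a

Subcommutative : Rel A ℓ → Set _
Subcommutative _⟶_ =
  ∀ {x y z} → x ⟶ y → x ⟶ z → ∃ λ w → ReflClosure _⟶_ y w × ReflClosure _⟶_ z w

module _ {_⟶_ : Rel A ℓ} (subcomm : Subcommutative _⟶_) where

  private
    _—↠_ = Star _⟶_
    _⟶⁼_ = ReflClosure _⟶_

    ⟶⁼⇒—↠ : ∀ {x y} → x ⟶⁼ y → x —↠ y
    ⟶⁼⇒—↠ refl  = ε
    ⟶⁼⇒—↠ [ r ] = r ◅ ε

  strip : ∀ {x y z} → x ⟶ y → x —↠ z → ∃ λ w → y —↠ w × z ⟶⁼ w
  strip r ε = _ , ε , [ r ]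
  strip r (s ◅ rs) with subcomm r s
  ... | _ , r⁼ , refl  = _ , ⟶⁼⇒—↠ r⁼ ◅◅ rs , refl
  ... | _ , r⁼ , [ t ] with strip t rs
  ...   | w , ts , z⟶⁼w = w , ⟶⁼⇒—↠ r⁼ ◅◅ ts , z⟶⁼w

  subcommutative⇒confluent : Confluent _⟶_
  subcommutative⇒confluent ε       qs = _ , qs , ε
  subcommutative⇒confluent (r ◅ rs) qs with strip r qs
  ... | _ , ts , z⟶⁼v with subcommutative⇒confluent rs ts
  ...   | w , ys , vs = w , ys , ⟶⁼⇒—↠ z⟶⁼v ◅◅ vs

≡just⇒≢nothing : ∀ {m : Maybe A} {y : A} → m ≡ just y → m ≢ nothing
≡just⇒≢nothing refl ()

module _ {k : ℕ} (C : QuasiCrystal k) where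
  open QuasiCrystal C

  raise-subcommutative : LQ3 C → Subcommutative (Raise C)
  raise-subcommutative lq3 {x} (i , p) (j , q) with i ≟ j
  ... | yes refl with just-injective (trans (sym p) q)
  ...   | refl = _ , refl , refl
  raise-subcommutative lq3 {x} (i , p) (j , q) | no i≢j
    with lq3 i j x i≢j (≡just⇒≢nothing p) (≡just⇒≢nothing q)
  ... | w , ëᵢëⱼx≡w , ëⱼëᵢx≡w rewrite p | q = w , [ j , ëⱼëᵢx≡w ] , [ i , ëᵢëⱼx≡w ]

  highestWeight⇒normalForm : ∀ {x} → HighestWeight C x → IsNormalForm (Raise C) x
  highestWeight⇒normalForm hw (_ , i , p) = ≡just⇒≢nothing p (hw i)

  connected⇒raise-equivalent : Connected C → ∀ x y → EqClosure (Raise C) x y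
  connected⇒raise-equivalent conn x y = fold (isEquivalence _) edge⇒reverse-raise (conn x y)
    where
    edge⇒reverse-raise : ∀ {u v} → Edge C u v → EqClosure (Raise C) u v
    edge⇒reverse-raise {u} {v} (i , p) =
      symmetric _ (return (i , proj₂ (Q1-iff i v u) p))

theorem3p7 : (k : ℕ) (C : QuasiCrystal k) →
    Connected C → BoundedAbove C → LQ1 C → LQ2 C → LQ3 C → LQ3′ C →
    ∃ λ xh → HighestWeight C xh × (∀ y → HighestWeight C y → y ≡ xh)
theorem3p7 k C conn bounded _ _ lq3 _ with bounded (QuasiCrystal.elt C)
... | xh , xh-hw , _ = xh , xh-hw , λ y y-hw →
  conf⇒unf (subcommutative⇒confluent (raise-subcommutative C lq3))
    (highestWeight⇒normalForm C y-hw) (highestWeight⇒normalForm C xh-hw)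
    (connected⇒raise-equivalent C conn y xh)
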